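{- Let $X$ be a set and $a,b\in\mathfrak{P}(\Sigma)^X$ with $a_x\subseteq b_x$ for all $x\in X$. Then $[\![\dot{\textstyle\bigvee}\circ a]\!]_X\le[\![\dot{\textstyle\bigvee}\circ b]\!]_X$ and $[\![\dot{\textstyle\bigwedge}\circ a]\!]_X\ge[\![\dot{\textstyle\bigwedge}\circ b]\!]_X$ in $\mathsf{P}X$.
   Context: $\mathsf{P}:\mathbf{Set}^{\mathrm{op}}\to\mathbf{HA}$ is a $\mathbf{Set}$-based tripos: a functor into Heyting algebras such that (1) each $\mathsf{P}f:\mathsf{P}Y\to\mathsf{P}X$ ($f:X\to Y$) has a left adjoint $\exists f$ and right adjoint $\forall f$ among monotone maps $\mathsf{P}X\to\mathsf{P}Y$; (2) for every pullback square in $\mathbf{Set}$ with $f_1:X\to X_1,f_2:X\to X_2,g_1:X_1\to Y,g_2:X_2\to Y$, $\exists f_1\circ\mathsf{P}f_2=\mathsf{P}g_1\circ\exists g_2$ and $\forall f_1\circ\mathsf{P}f_2=\mathsf{P}g_1\circ\forall g_2$; (3) there is a set $\Sigma$ and $\mathrm{tr}_\Sigma\in\mathsf{P}\Sigma$ with $\sigma\mapsto\mathsf{P}\sigma(\mathrm{tr}_\Sigma)$, $\Sigma^X\to\mathsf{P}X$, surjective for every set $X$. Fix these; for $\sigma\in\Sigma^X$ write $[\![\sigma]\!]_X:=\mathsf{P}\sigma(\mathrm{tr}_\Sigma)$. Let $E=\{(\xi,s)\in\Sigma\times\mathfrak{P}(\Sigma):\xi\in s\}$ with projections $e_1:E\to\Sigma$,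 $e_2:E\to\mathfrak{P}(\Sigma)$, and let $\dot\bigvee,\dot\bigwedge:\mathfrak{P}(\Sigma)\to\Sigma$ be any maps with $[\![\dot\bigvee]\!]_{\mathfrak{P}(\Sigma)}=\exists e_2([\![e_1]\!]_E)$ and $[\![\dot\bigwedge]\!]_{\mathfrak{P}(\Sigma)}=\forall e_2([\![e_1]\!]_E)$. The axiom of choice is assumed. -}

module Defs where

open import Level using (Level; _⊔_; suc; 0ℓ)
open import Data.Product using (Σ; Σ-syntax; _×_; _,_; proj₁; proj₂; ∃; ∃-syntax)
open import Relation.Binary.PropositionalEquality using (_≡_)
open import Relation.Binary.Lattice.Bundles using (HeytingAlgebra)
open import Relation.Unary using (Pred; _∈_; _⊆_)

-- "Sets" are the types in Set₁; this is the base category Set.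
-- Subsets of a set A are predicates A → Set (so the power set 𝔓(A) = Pred A 0ℓ lives in Set₁ again).

∃!≡ : {A : Set₁} → (A → Set₁) → Set₁
∃!≡ {A} P = Σ[ x ∈ A ] (P x × ((y : A) → P y → x ≡ y))

record IsPullback {X X₁ X₂ Y : Set₁}
                  (f₁ : X → X₁) (f₂ : X → X₂) (g₁ : X₁ → Y) (g₂ : X₂ → Y) : Set₁ where
  field
    commutes  : (x : X) → g₁ (f₁ x) ≡ g₂ (f₂ x)
    universal : (x₁ : X₁) (x₂ : X₂) → g₁ x₁ ≡ g₂ x₂ →
                ∃!≡ (λ x → (f₁ x ≡ x₁) × (f₂ x ≡ x₂))

record Tripos (c ℓ₁ ℓ₂ : Level) : Set (suc (suc 0ℓ ⊔ c ⊔ ℓ₁ ⊔ ℓ₂)) where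
  field
    𝓟 : Set₁ → HeytingAlgebra c ℓ₁ ℓ₂

  module H (X : Set₁) = HeytingAlgebra (𝓟 X)

  ∣_∣ : Set₁ → Set c
  ∣ X ∣ = H.Carrier X

  field
    P : {X Y : Set₁} → (X → Y) → ∣ Y ∣ → ∣ X ∣
    P-cong  : {X Y : Set₁} (f : X → Y) {φ ψ : ∣ Y ∣} → H._≈_ Y φ ψ → H._≈_ X (P f φ) (P f ψ)
    P-mono  : {X Y : Set₁} (f : X → Y) {φ ψ : ∣ Y ∣} → H._≤_ Y φ ψ → H._≤_ X (P f φ) (P f ψ)
    P-⊤     : {X Y : Set₁} (f : X → Y) → H._≈_ X (P f (H.⊤ Y)) (H.⊤ X)
    P-⊥     : {X Y : Set₁} (f : X → Y) → H._≈_ X (P f (H.⊥ Y)) (H.⊥ X)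
    P-∧     : {X Y : Set₁} (f : X → Y) (φ ψ : ∣ Y ∣) →
              H._≈_ X (P f (H._∧_ Y φ ψ)) (H._∧_ X (P f φ) (P f ψ))
    P-∨     : {X Y : Set₁} (f : X → Y) (φ ψ : ∣ Y ∣) →
              H._≈_ X (P f (H._∨_ Y φ ψ)) (H._∨_ X (P f φ) (P f ψ))
    P-⇨     : {X Y : Set₁} (f : X → Y) (φ ψ : ∣ Y ∣) →
              H._≈_ X (P f (H._⇨_ Y φ ψ)) (H._⇨_ X (P f φ) (P f ψ))
    -- functoriality (functions in Set are extensional)
    P-ext   : {X Y : Set₁} (f g : X → Y) → ((x : X) → f x ≡ g x) →
              (φ : ∣ Y ∣) → H._≈_ X (P f φ) (P g φ)
    P-id    : {X : Set₁} (φ : ∣ X ∣) → H._≈_ X (P (λ x → x) φ) φ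
    P-∘     : {X Y Z : Set₁} (f : X → Y) (g : Y → Z) (φ : ∣ Z ∣) →
              H._≈_ X (P (λ x → g (f x)) φ) (P f (P g φ))

    ∃P ∀P   : {X Y : Set₁} → (X → Y) → ∣ X ∣ → ∣ Y ∣
    ∃-mono  : {X Y : Set₁} (f : X → Y) {φ ψ : ∣ X ∣} → H._≤_ X φ ψ → H._≤_ Y (∃P f φ) (∃P f ψ)
    ∀-mono  : {X Y : Set₁} (f : X → Y) {φ ψ : ∣ X ∣} → H._≤_ X φ ψ → H._≤_ Y (∀P f φ) (∀P f ψ)
    ∃⊣P     : {X Y : Set₁} (f : X → Y) (φ : ∣ X ∣) (ψ : ∣ Y ∣) →
              (H._≤_ Y (∃P f φ) ψ → H._≤_ X φ (P f ψ)) × (H._≤_ X φ (P f ψ) → H._≤_ Y (∃P f φ) ψ)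
    P⊣∀     : {X Y : Set₁} (f : X → Y) (ψ : ∣ Y ∣) (φ : ∣ X ∣) →
              (H._≤_ X (P f ψ) φ → H._≤_ Y ψ (∀P f φ)) × (H._≤_ Y ψ (∀P f φ) → H._≤_ X (P f ψ) φ)

    BC-∃    : {X X₁ X₂ Y : Set₁} (f₁ : X → X₁) (f₂ : X → X₂) (g₁ : X₁ → Y) (g₂ : X₂ → Y) →
              IsPullback f₁ f₂ g₁ g₂ →
              (φ : ∣ X₂ ∣) → H._≈_ X₁ (∃P f₁ (P f₂ φ)) (P g₁ (∃P g₂ φ))
    BC-∀    : {X X₁ X₂ Y : Set₁} (f₁ : X → X₁) (f₂ : X → X₂) (g₁ : X₁ → Y) (g₂ : X₂ → Y) →
              IsPullback f₁ f₂ g₁ g₂ →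
              (φ : ∣ X₂ ∣) → H._≈_ X₁ (∀P f₁ (P f₂ φ)) (P g₁ (∀P g₂ φ))

    Sig  : Set₁
    tr   : ∣ Sig ∣
    generic : (X : Set₁) (φ : ∣ X ∣) → Σ[ σ ∈ (X → Sig) ] H._≈_ X (P σ tr) φ

  ⟦_⟧ : {X : Set₁} → (X → Sig) → ∣ X ∣
  ⟦ σ ⟧ = P σ tr

  𝔓Sig : Set₁
  𝔓Sig = Pred Sig 0ℓ

  E : Set₁
  E = Σ[ p ∈ Sig × 𝔓Sig ] (proj₁ p ∈ proj₂ p)

  e₁ : E → Sig
  e₁ ((ξ , s) , _) = ξ

  e₂ : E → 𝔓Sig
  e₂ ((ξ , s) , _) = s

-- Pulling ⋁̇ back along a : X → 𝔓(Σ) and applying Beck–Chevalley to the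
-- pullback of e₂ along a shows that ⟦⋁̇ ∘ a⟧ = ∃π (θ_a), where π projects the
-- total space {(x , ξ) : ξ ∈ a x} onto X and θ_a = ⟦(x , ξ) ↦ ξ⟧; dually
-- ⟦⋀̇ ∘ a⟧ = ∀π (θ_a). For a ⊆ b the total space of a includes into that of b
-- over X and θ_a is the restriction of θ_b, so the claim is the
-- monotonicity of ∃ and antitonicity of ∀ under such a restriction.
module Submission where

open import Defs
open import Level using (Level)
open import Relation.Unary using (_⊆_)
open import Data.Product using (_×_; Σ-syntax; _,_; proj₁; proj₂)
open import Relation.Binary.PropositionalEquality using (_≡_; refl)
import Relation.Binary.Reasoning.PartialOrder as PosetReasoning

module _ {c ℓ₁ ℓ₂ : Level} (T : Tripos c ℓ₁ ℓ₂) where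
  open Tripos T

  Elem : {X : Set₁} → (X → 𝔓Sig) → Set₁
  Elem {X} a = Σ[ x ∈ X ] Σ[ ξ ∈ Sig ] a x ξ

  Elem-base : {X : Set₁} {a : X → 𝔓Sig} → Elem a → X
  Elem-base (x , _ , _) = x

  Elem-toE : {X : Set₁} {a : X → 𝔓Sig} → Elem a → E
  Elem-toE {a = a} (x , ξ , ξ∈ax) = (ξ , a x) , ξ∈ax

  Elem-map : {X : Set₁} {a b : X → 𝔓Sig} → (∀ x → a x ⊆ b x) → Elem a → Elem b
  Elem-map a⊆b (x , ξ , ξ∈ax) = x , ξ , a⊆b x ξ∈ax

  Elem-isPullback : {X : Set₁} (a : X → 𝔓Sig) →
                    IsPullback (Elem-base {a = a}) (Elem-toE {a = a}) a e₂
  Elem-isPullback {X} a = record { commutes = λ _ → refl ; universal = universal }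
    where
    universal : (x : X) (e : E) → a x ≡ e₂ e →
                ∃!≡ (λ y → (Elem-base {a = a} y ≡ x) × (Elem-toE {a = a} y ≡ e))
    universal x ((ξ , _) , ξ∈ax) refl = (x , ξ , ξ∈ax) , (refl , refl) , unique
      where
      unique : (y : Elem a) →
               (Elem-base {a = a} y ≡ x) × (Elem-toE {a = a} y ≡ ((ξ , a x) , ξ∈ax)) →
               (x , ξ , ξ∈ax) ≡ y
      unique _ (refl , refl) = refl

  P-∘-≈ : {A B X : Set₁} {i : A → B} {g : B → X} {f : A → X} →
          (∀ y → g (i y) ≡ f y) → (ψ : ∣ X ∣) → H._≈_ A (P i (P g ψ)) (P f ψ)
  P-∘-≈ {A} {i = i} {g} {f} gi≡f ψ =
    H.Eq.trans A (H.Eq.sym A (P-∘ i g ψ)) (P-ext (λ y → g (i y)) f gi≡f ψ)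

  ∃-restrict-≤ : {A B X : Set₁} (i : A → B) {f : A → X} {g : B → X} →
                 (∀ y → g (i y) ≡ f y) → {φ : ∣ A ∣} {θ : ∣ B ∣} →
                 H._≤_ A φ (P i θ) → H._≤_ X (∃P f φ) (∃P g θ)
  ∃-restrict-≤ {A} {X = X} i {f} {g} gi≡f {φ} {θ} φ≤θi = proj₂ (∃⊣P f φ (∃P g θ)) (begin
    φ                   ≤⟨ φ≤θi ⟩
    P i θ               ≤⟨ P-mono i (proj₁ (∃⊣P g θ (∃P g θ)) (H.refl X)) ⟩
    P i (P g (∃P g θ))  ≈⟨ P-∘-≈ gi≡f (∃P g θ) ⟩
    P f (∃P g θ)        ∎)
    where
    open PosetReasoning (H.poset A)

  ∀-restrict-≤ : {A B X : Set₁} (i : A → B) {f : A → X} {g : B → X} →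
                 (∀ y → g (i y) ≡ f y) → {φ : ∣ A ∣} {θ : ∣ B ∣} →
                 H._≤_ A (P i θ) φ → H._≤_ X (∀P g θ) (∀P f φ)
  ∀-restrict-≤ {A} {X = X} i {f} {g} gi≡f {φ} {θ} θi≤φ = proj₁ (P⊣∀ f (∀P g θ) φ) (begin
    P f (∀P g θ)        ≈⟨ H.Eq.sym A (P-∘-≈ gi≡f (∀P g θ)) ⟩
    P i (P g (∀P g θ))  ≤⟨ P-mono i (proj₂ (P⊣∀ g (∀P g θ) θ) (H.refl X)) ⟩
    P i θ               ≤⟨ θi≤φ ⟩
    φ                   ∎)
    where
    open PosetReasoning (H.poset A)

  Elem-generic : {X : Set₁} (a : X → 𝔓Sig) → ∣ Elem a ∣
  Elem-generic a = P (Elem-toE {a = a}) ⟦ e₁ ⟧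

  Elem-generic-restrict : {X : Set₁} {a b : X → 𝔓Sig} (a⊆b : ∀ x → a x ⊆ b x) →
                          H._≈_ (Elem a) (P (Elem-map a⊆b) (Elem-generic b)) (Elem-generic a)
  Elem-generic-restrict {a = a} {b} a⊆b = begin-equality
    P (Elem-map a⊆b) (P (Elem-toE {a = b}) (P e₁ tr))
      ≈⟨ P-cong (Elem-map a⊆b) (H.Eq.sym (Elem b) (P-∘ (Elem-toE {a = b}) e₁ tr)) ⟩
    P (Elem-map a⊆b) (P (λ y → e₁ (Elem-toE y)) tr)
      ≈⟨ P-∘-≈ (λ _ → refl) tr ⟩
    P (λ y → e₁ (Elem-toE {a = a} y)) tr
      ≈⟨ P-∘ (Elem-toE {a = a}) e₁ tr ⟩
    P (Elem-toE {a = a}) (P e₁ tr)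
      ∎
    where
    open PosetReasoning (H.poset (Elem a))

  ⟦∘⟧-∃-Elem : (γ : 𝔓Sig → Sig) → H._≈_ 𝔓Sig ⟦ γ ⟧ (∃P e₂ ⟦ e₁ ⟧) →
               {X : Set₁} (a : X → 𝔓Sig) →
               H._≈_ X ⟦ (λ x → γ (a x)) ⟧ (∃P (Elem-base {a = a}) (Elem-generic a))
  ⟦∘⟧-∃-Elem γ ⟦γ⟧≈ {X} a = begin-equality
    ⟦ (λ x → γ (a x)) ⟧                          ≈⟨ P-∘ a γ tr ⟩
    P a ⟦ γ ⟧                                    ≈⟨ P-cong a ⟦γ⟧≈ ⟩
    P a (∃P e₂ ⟦ e₁ ⟧)                           ≈⟨ H.Eq.sym X (BC-∃ _ _ a e₂ (Elem-isPullback a) ⟦ e₁ ⟧) ⟩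
    ∃P (Elem-base {a = a}) (Elem-generic a)      ∎
    where
    open PosetReasoning (H.poset X)

  ⟦∘⟧-∀-Elem : (γ : 𝔓Sig → Sig) → H._≈_ 𝔓Sig ⟦ γ ⟧ (∀P e₂ ⟦ e₁ ⟧) →
               {X : Set₁} (a : X → 𝔓Sig) →
               H._≈_ X ⟦ (λ x → γ (a x)) ⟧ (∀P (Elem-base {a = a}) (Elem-generic a))
  ⟦∘⟧-∀-Elem γ ⟦γ⟧≈ {X} a = begin-equality
    ⟦ (λ x → γ (a x)) ⟧                          ≈⟨ P-∘ a γ tr ⟩
    P a ⟦ γ ⟧                                    ≈⟨ P-cong a ⟦γ⟧≈ ⟩
    P a (∀P e₂ ⟦ e₁ ⟧)                           ≈⟨ H.Eq.sym X (BC-∀ _ _ a e₂ (Elem-isPullback a) ⟦ e₁ ⟧) ⟩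
    ∀P (Elem-base {a = a}) (Elem-generic a)      ∎
    where
    open PosetReasoning (H.poset X)

  Elem-∃-mono : {X : Set₁} {a b : X → 𝔓Sig} → (∀ x → a x ⊆ b x) →
                H._≤_ X (∃P (Elem-base {a = a}) (Elem-generic a)) (∃P (Elem-base {a = b}) (Elem-generic b))
  Elem-∃-mono {a = a} a⊆b = ∃-restrict-≤ (Elem-map a⊆b) (λ _ → refl)
    (H.reflexive (Elem a) (H.Eq.sym (Elem a) (Elem-generic-restrict a⊆b)))

  Elem-∀-anti : {X : Set₁} {a b : X → 𝔓Sig} → (∀ x → a x ⊆ b x) →
                H._≤_ X (∀P (Elem-base {a = b}) (Elem-generic b)) (∀P (Elem-base {a = a}) (Elem-generic a))
  Elem-∀-anti {a = a} a⊆b = ∀-restrict-≤ (Elem-map a⊆b) (λ _ → refl)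
    (H.reflexive (Elem a) (Elem-generic-restrict a⊆b))

corollary2p13 : {c ℓ₁ ℓ₂ : Level} (T : Tripos c ℓ₁ ℓ₂) →
    let open Tripos T in
    (⋁̇ ⋀̇ : 𝔓Sig → Sig) →
    H._≈_ 𝔓Sig ⟦ ⋁̇ ⟧ (∃P e₂ ⟦ e₁ ⟧) →
    H._≈_ 𝔓Sig ⟦ ⋀̇ ⟧ (∀P e₂ ⟦ e₁ ⟧) →
    (X : Set₁) (a b : X → 𝔓Sig) → ((x : X) → a x ⊆ b x) →
    H._≤_ X ⟦ (λ x → ⋁̇ (a x)) ⟧ ⟦ (λ x → ⋁̇ (b x)) ⟧ ×
    H._≤_ X ⟦ (λ x → ⋀̇ (b x)) ⟧ ⟦ (λ x → ⋀̇ (a x)) ⟧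
corollary2p13 T ⋁̇ ⋀̇ ⟦⋁̇⟧≈ ⟦⋀̇⟧≈ X a b a⊆b = ⋁̇-mono , ⋀̇-anti
  where
  open Tripos T
  open PosetReasoning (H.poset X)

  ⋁̇-mono : H._≤_ X ⟦ (λ x → ⋁̇ (a x)) ⟧ ⟦ (λ x → ⋁̇ (b x)) ⟧
  ⋁̇-mono = begin
    ⟦ (λ x → ⋁̇ (a x)) ⟧                    ≈⟨ ⟦∘⟧-∃-Elem T ⋁̇ ⟦⋁̇⟧≈ a ⟩
    ∃P (Elem-base T) (Elem-generic T a)    ≤⟨ Elem-∃-mono T a⊆b ⟩
    ∃P (Elem-base T) (Elem-generic T b)    ≈⟨ H.Eq.sym X (⟦∘⟧-∃-Elem T ⋁̇ ⟦⋁̇⟧≈ b) ⟩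
    ⟦ (λ x → ⋁̇ (b x)) ⟧                    ∎

  ⋀̇-anti : H._≤_ X ⟦ (λ x → ⋀̇ (b x)) ⟧ ⟦ (λ x → ⋀̇ (a x)) ⟧
  ⋀̇-anti = begin
    ⟦ (λ x → ⋀̇ (b x)) ⟧                    ≈⟨ ⟦∘⟧-∀-Elem T ⋀̇ ⟦⋀̇⟧≈ b ⟩
    ∀P (Elem-base T) (Elem-generic T b)    ≤⟨ Elem-∀-anti T a⊆b ⟩
    ∀P (Elem-base T) (Elem-generic T a)    ≈⟨ H.Eq.sym X (⟦∘⟧-∀-Elem T ⋀̇ ⟦⋀̇⟧≈ a) ⟩
    ⟦ (λ x → ⋀̇ (a x)) ⟧                    ∎
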